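{- Let $(B_n)_{n\ge0}$ be the balancing numbers, $B_0=0$, $B_1=1$, $B_n=6B_{n-1}-B_{n-2}$, and $(D_n)_{n\ge0}$ the double Lucas-balancing numbers, $D_0=2$, $D_1=6$, $D_n=6D_{n-1}-D_{n-2}$. Then for all $n\ge1$, $$\sum_{i=1}^n i B_i = \frac{1}{4} \bigl( n B_{n+1} - (n+1) B_{n} \bigr), \qquad \sum_{i=1}^n i D_i = \frac{1}{4} \bigl( n D_{n+1} - (n+1) D_{n} + 2 \bigr).$$ -}

module Defs where

open import Data.Nat using (ℕ; zero; suc)
open import Data.Integer using (ℤ; +_; _+_; _-_; _*_)

B : ℕ → ℤ
B zero = + 0
B (suc zero) = + 1
B (suc (suc n)) = + 6 * B (suc n) - B n

D : ℕ → ℤ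
D zero = + 2
D (suc zero) = + 6
D (suc (suc n)) = + 6 * D (suc n) - D n

weightedSum : (ℕ → ℤ) → ℕ → ℤ
weightedSum f zero = + 0
weightedSum f (suc n) = weightedSum f n + (+ suc n) * f (suc n)

-- Both sequences satisfy f (n+2) = 6 f (n+1) - f n.  For any such f,
-- 4 Σ_{i≤n} i f i = n f (n+1) - (n+1) f n + f 0 by induction on n: adding
-- 4 (n+1) f (n+1) to the right-hand side and using 6 f (n+1) - f n = f (n+2)
-- gives the right-hand side at n+1.  B 0 = 0 and D 0 = 2 give the two identities.
module Submission where

open import Defs
open import Data.Nat using (ℕ; suc; _≥_)
open import Data.Integer using (ℤ; +_; _+_; _-_; _*_)
open import Data.Integer.Properties using (*-distribˡ-+; +-identityʳ)
open import Data.Integer.Tactic.RingSolver using (solve-∀)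
open import Data.Product using (_×_; _,_)
open import Relation.Binary.PropositionalEquality using (_≡_; refl; sym; trans; cong; module ≡-Reasoning)

SixRecurrence : (ℕ → ℤ) → Set
SixRecurrence f = ∀ n → f (suc (suc n)) ≡ + 6 * f (suc n) - f n

B-sixRecurrence : SixRecurrence B
B-sixRecurrence _ = refl

D-sixRecurrence : SixRecurrence D
D-sixRecurrence _ = refl

weightedClosedForm : (ℕ → ℤ) → ℕ → ℤ
weightedClosedForm f n = + n * f (suc n) - + suc n * f n + f 0

weightedClosedForm-zero : ∀ (a b : ℤ) → + 0 ≡ + 0 * b - + 1 * a + a
weightedClosedForm-zero = solve-∀

weightedClosedForm-step : ∀ (n a b c : ℤ) →
  (n * b - (+ 1 + n) * a + c) + + 4 * ((+ 1 + n) * b)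
    ≡ (+ 1 + n) * (+ 6 * b - a) - (+ 2 + n) * b + c
weightedClosedForm-step = solve-∀

weightedSum-closedForm : ∀ f → SixRecurrence f →
  ∀ n → + 4 * weightedSum f n ≡ weightedClosedForm f n
weightedSum-closedForm f rec 0 = weightedClosedForm-zero (f 0) (f 1)
weightedSum-closedForm f rec (suc n) = begin
  + 4 * (weightedSum f n + + suc n * f (suc n))
    ≡⟨ *-distribˡ-+ (+ 4) (weightedSum f n) _ ⟩
  + 4 * weightedSum f n + + 4 * (+ suc n * f (suc n))
    ≡⟨ cong (_+ + 4 * (+ suc n * f (suc n))) (weightedSum-closedForm f rec n) ⟩
  weightedClosedForm f n + + 4 * (+ suc n * f (suc n))
    ≡⟨ weightedClosedForm-step (+ n) (f n) (f (suc n)) (f 0) ⟩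
  + suc n * (+ 6 * f (suc n) - f n) - + suc (suc n) * f (suc n) + f 0
    ≡⟨ cong (λ z → + suc n * z - + suc (suc n) * f (suc n) + f 0) (sym (rec n)) ⟩
  weightedClosedForm f (suc n) ∎
  where open ≡-Reasoning

theorem5p6 : (n : ℕ) → n ≥ 1 →
    ((+ 4) * weightedSum B n ≡ (+ n) * B (suc n) - (+ suc n) * B n)
    × ((+ 4) * weightedSum D n ≡ (+ n) * D (suc n) - (+ suc n) * D n + (+ 2))
theorem5p6 n _ =
  trans (weightedSum-closedForm B B-sixRecurrence n) (+-identityʳ _) ,
  weightedSum-closedForm D D-sixRecurrence n
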